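{- Let $(G,k,r,d)$ be an instance of Diverse Vertex Cover and let $\mathcal{D}=(T,q,\mathcal{X})$ be a rooted tree decomposition of $G$. For each node $t$ let $\mathcal{I}_t$ be the set of tuples $((S_1,s_1),\ldots,(S_r,s_r),\ell)$ with $\ell\in\{0,\ldots,d\}$ and, for each $i\in\{1,\ldots,r\}$, $S_i\subseteq X_t$ and $s_i\in\{0,\ldots,k\}$. Define $\mathcal{R}_t\subseteq\mathcal{I}_t$ (inductively from the leaves) as the set of tuples $((S_1,s_1),\ldots,(S_r,s_r),\ell)\in\mathcal{I}_t$ such that: (1) for each $j\in\{1,\ldots,r\}$, $G[X_t\setminus S_j]$ has no edges; and (2) for each child $t_i$ of $t$, $i\in\{1,\ldots,\delta(t)\}$, there is a tuple $((S^i_1,s^i_1),\ldots,(S^i_r,s^i_r),\ell_i)\in\mathcal{R}_{t_i}$ such that (a) $S_j\cap X_{t_i}=S^i_j\cap X_t$ for all $i\in\{1,\ldots,\delta(t)\}$ and $j\in\{1,\ldots,r\}$, (b) $s_j=|\mathrm{forg}(t)\cap S_j|+\sum_{i=1}^{\delta(t)}s^i_j$ for each $j$, and (c) $\ell=\min(d,m)$ where $m=\sum_{v\in\mathrm{forg}(t)}I(S_1,\ldots,S_r,v)+\sum_{i=1}^{\delta(t)}\ell_i$. Then $(G,k,r,d)$ is a yes-instance of Diverse Vertex Cover if and only if there is a tuple $((S_1,s_1),\ldots,(S_r,s_r),\ell)\in\mathcal{R}_q$ with $\ell=d$.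
   Context: Diverse Vertex Cover: given a graph $G$ and integers $k,r,d$, decide whether there exist vertex covers $S_1,\ldots,S_r$ of $G$, each of size at most $k$, with $\sum_{1\le i<j\le r}(|S_i\setminus S_j|+|S_j\setminus S_i|)\ge d$. A rooted tree decomposition is $(T,q,\mathcal{X})$ with $T$ a tree rooted at $q$, bags $X_t\subseteq V(G)$ covering $V(G)$, every edge in some bag, and $X_x\cap X_y\subseteq X_z$ whenever $z$ lies on the $x$–$y$ path; by convention the root bag $X_q$ is empty, each node $t$ has $\delta(t)\le 2$ children, and each bag has at most one vertex not in a child bag. For a non-root node $t$ with parent $t'$, $\mathrm{forg}(t)=X_t\setminus X_{t'}$, and $\mathrm{forg}(q)=\emptyset$. For sets $S_1,\ldots,S_r$ and a vertex $v$, $I(S_1,\ldots,S_r,v)=|\{\ell: v\in S_\ell\}|\cdot|\{\ell: v\notin S_\ell\}|$. -}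

module Defs where

open import Data.Bool using (Bool; true; false; if_then_else_)
open import Data.Nat using (ℕ; zero; suc; _+_; _*_; _≤_; _<ᵇ_; _⊓_)
open import Data.Fin using (Fin; toℕ)
open import Data.Fin.Subset using (Subset; _∈_; _⊆_; _∩_; _─_; ⋃; ∣_∣; ⊥)
open import Data.Vec using (lookup)
open import Data.List using (List; []; _∷_; map; length; _++_)
import Data.List as L
import Data.Nat.ListAction as LA
open import Data.Maybe using (Maybe; just; nothing)
open import Data.Product using (Σ; ∃; _×_; _,_)
open import Data.Sum using (_⊎_)
open import Data.Unit using (⊤)
import Data.Empty as E
open import Relation.Binary.PropositionalEquality using (_≡_)

∑ : ∀ {m} → (Fin m → ℕ) → ℕ
∑ {zero}  f = 0
∑ {suc m} f = f Fin.zero + ∑ (λ i → f (Fin.suc i))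
  where import Data.Fin as Fin

sumL : List ℕ → ℕ
sumL = LA.sum

IsSimpleGraph : (n : ℕ) → (Fin n → Fin n → Bool) → Set
IsSimpleGraph n E = (∀ u v → E u v ≡ E v u) × (∀ v → E v v ≡ false)

module _ {n : ℕ} (E : Fin n → Fin n → Bool) where

  IsVertexCover : Subset n → Set
  IsVertexCover S = ∀ u v → E u v ≡ true → u ∈ S ⊎ v ∈ S

  symDiff : Subset n → Subset n → ℕ
  symDiff S S' = ∣ S ─ S' ∣ + ∣ S' ─ S ∣

  diversity : ∀ {r} → (Fin r → Subset n) → ℕ
  diversity S = ∑ (λ i → ∑ (λ j → if toℕ i <ᵇ toℕ j then symDiff (S i) (S j) else 0))

  DiverseVC : (k r d : ℕ) → Set
  DiverseVC k r d = Σ (Fin r → Subset n) λ S →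
    (∀ i → IsVertexCover (S i)) × (∀ i → ∣ S i ∣ ≤ k) × (d ≤ diversity S)

I : ∀ {n r} → (Fin r → Subset n) → Fin n → ℕ
I S v = ∑ (λ l → if lookup (S l) v then 1 else 0)
      * ∑ (λ l → if lookup (S l) v then 0 else 1)

-- Rooted trees with bags: a node carries its bag and the list of its
-- children.  The root of a value T : Tree n is the node q.

data Tree (n : ℕ) : Set where
  node : Subset n → List (Tree n) → Tree n

bag : ∀ {n} → Tree n → Subset n
bag (node X _) = X

children : ∀ {n} → Tree n → List (Tree n)
children (node _ ts) = ts

-- SubtreeAt T p t : the node of T at address p (a list of child
-- indices, read from the root) is the root of the subtree t.
data SubtreeAt {n : ℕ} : Tree n → List ℕ → Tree n → Set where
  here  : ∀ {t} → SubtreeAt t [] t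
  there : ∀ {X ts p t} (i : Fin (length ts)) →
          SubtreeAt (L.lookup ts i) p t →
          SubtreeAt (node X ts) (toℕ i ∷ p) t

_≼_ : List ℕ → List ℕ → Set
z ≼ x = ∃ λ w → z ++ w ≡ x

-- In a rooted tree, the x–y path consists of the nodes that are
-- ancestors-or-equal of x or of y, and are descendants-or-equal of every
-- common ancestor of x and y (i.e. of their lowest common ancestor).
OnPath : List ℕ → List ℕ → List ℕ → Set
OnPath x y z = (z ≼ x ⊎ z ≼ y) × (∀ w → w ≼ x → w ≼ y → w ≼ z)

-- (T,q,X) is a rooted tree decomposition of G, with the conventions:
-- root bag empty, ≤ 2 children per node, and each bag has at most one
-- vertex not in a child bag.
IsRootedTD : ∀ {n} → (Fin n → Fin n → Bool) → Tree n → Set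
IsRootedTD {n} E T =
    (∀ v → Σ (List ℕ) λ p → Σ (Tree n) λ t → SubtreeAt T p t × v ∈ bag t)
  × (∀ u v → E u v ≡ true →
       Σ (List ℕ) λ p → Σ (Tree n) λ t → SubtreeAt T p t × u ∈ bag t × v ∈ bag t)
  × (∀ x y z tx ty tz → SubtreeAt T x tx → SubtreeAt T y ty → SubtreeAt T z tz →
       OnPath x y z → (bag tx ∩ bag ty) ⊆ bag tz)
  × (bag T ≡ ⊥)
  × (∀ p t → SubtreeAt T p t → length (children t) ≤ 2)
  × (∀ p t → SubtreeAt T p t → ∣ bag t ─ ⋃ (map bag (children t)) ∣ ≤ 1)

-- forg(t) = X_t \ X_{parent}, and forg(q) = ∅ (parent = nothing at root)

forg : ∀ {n} → Maybe (Subset n) → Subset n → Subset n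
forg (just P) X = X ─ P
forg nothing  X = ⊥

record Tuple (n r : ℕ) : Set where
  constructor tuple
  field
    S : Fin r → Subset n
    s : Fin r → ℕ
    ℓ : ℕ
open Tuple public

module DP {n : ℕ} (E : Fin n → Fin n → Bool) (k r d : ℕ) where

  InI : Subset n → Tuple n r → Set
  InI X τ = (∀ j → S τ j ⊆ X) × (∀ j → s τ j ≤ k) × (ℓ τ ≤ d)

  mutual
    -- R par t τ : τ ∈ 𝓡_t, where par is the bag of the parent of t
    -- (nothing if t is the root)
    R : Maybe (Subset n) → Tree n → Tuple n r → Set
    R par (node X ts) τ =
        InI X τ
      × (∀ j u v → E u v ≡ true → u ∈ X ─ S τ j → v ∈ X ─ S τ j → E.⊥)
      × Σ (List (Tuple n r)) λ τs →
          RCh X (S τ) ts τs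
        × (∀ j → s τ j ≡ ∣ forg par X ∩ S τ j ∣ + sumL (map (λ σ → s σ j) τs))
        × (ℓ τ ≡ d ⊓ (∑ (λ v → if lookup (forg par X) v then I (S τ) v else 0)
                      + sumL (map ℓ τs)))

    RCh : Subset n → (Fin r → Subset n) → List (Tree n) → List (Tuple n r) → Set
    RCh X S' []       []       = ⊤
    RCh X S' (t ∷ ts) (σ ∷ σs) =
      R (just X) t σ × (∀ j → S' j ∩ bag t ≡ S σ j ∩ X) × RCh X S' ts σs
    RCh X S' []       (_ ∷ _)  = E.⊥
    RCh X S' (_ ∷ _)  []       = E.⊥

-- Since the root bag is empty and, by the path property, the nodes whose bags contain a
-- vertex v form a subtree, v is forgotten at exactly one node: the top of that subtree.
-- Hence |S| and the diversity ∑ᵥ I(S₁,…,S_r,v) split over the nodes into contributions of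
-- the vertices forgotten there, which is what s_j and ℓ accumulate (capping ℓ at d at every
-- node gives the same result as capping the total once).  Restricting vertex covers S_j to
-- the bags therefore yields a tuple of 𝓡_q with ℓ = d.  Conversely, given a tuple of 𝓡_q, put
-- v into U_j iff v ∈ S_j at the node forgetting v.  Condition (a) carries membership in S_j
-- upwards as long as the vertex stays in the bag, so every edge, which lies in a bag where
-- condition (1) covers it, is covered by U_j; moreover |U_j| = s_j ≤ k and the diversity of
-- the U_j is at least ℓ = d.

module Submission where

open import Defs
open import Data.Bool using (Bool; true; false; if_then_else_; _∧_; _∨_; not; _xor_)
open import Data.Bool.ListAction using (any)
open import Data.Bool.Properties using (∧-zeroʳ; ∧-identityʳ; ∨-identityʳ; not-¬; T-≡)
open import Data.Empty using (⊥-elim) renaming (⊥ to Empty)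
open import Data.Fin using (Fin; toℕ) renaming (zero to fzero; suc to fsuc)
import Data.Fin.Properties as Finₚ
open import Data.Fin.Subset using (Subset; _∈_; _⊆_; _∩_; _─_; ∣_∣; ⊥)
open import Data.Fin.Subset.Properties using (p∩q⊆q; ∩-assoc; ∩-comm)
open import Data.List using (List; []; _∷_; map; length; _++_)
import Data.List as List
import Data.List.Properties as Listₚ
open import Data.List.Membership.Propositional using (lose) renaming (_∈_ to _∈ˡ_)
open import Data.List.Relation.Binary.Subset.Propositional using () renaming (_⊆_ to _⊆ˡ_)
open import Data.List.Relation.Binary.Subset.Propositional.Properties using (xs⊆xs++ys; xs⊆ys++xs)
open import Data.List.Relation.Unary.Any using (here; there)
open import Data.List.Relation.Unary.Any.Properties using (any⁺)
open import Data.Maybe using (Maybe; just; nothing)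
open import Data.Nat using (ℕ; zero; suc; _+_; _*_; _≤_; _<ᵇ_; _⊓_; z≤n; s≤s; _≟_)
open import Data.Nat.Properties
open import Algebra.Properties.CommutativeSemigroup +-commutativeSemigroup
  using (interchange; xy∙z≈xz∙y; xy∙z≈x∙zy)
open import Data.Nat.ListAction.Properties using (sum-++)
open import Data.Product using (Σ; _×_; _,_; proj₁; proj₂)
open import Data.Sum using (_⊎_; inj₁; inj₂)
open import Data.Unit using (tt)
open import Data.Vec using (_∷_; []; lookup; tabulate)
import Data.Vec.Properties as Vecₚ
open import Function using (_∘_; id)
open import Function.Bundles using (_⇔_; mk⇔; Equivalence)
open import Relation.Nullary using (yes; no)
open import Relation.Binary.PropositionalEquality
open ≡-Reasoning

∑-cong : ∀ {m} {f g : Fin m → ℕ} → (∀ i → f i ≡ g i) → ∑ f ≡ ∑ g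
∑-cong {zero}  f≗g = refl
∑-cong {suc m} f≗g = cong₂ _+_ (f≗g fzero) (∑-cong (f≗g ∘ fsuc))

∑-zero : ∀ m → ∑ {m} (λ _ → 0) ≡ 0
∑-zero zero    = refl
∑-zero (suc m) = ∑-zero m

∑-distrib-+ : ∀ {m} (f g : Fin m → ℕ) → ∑ (λ i → f i + g i) ≡ ∑ f + ∑ g
∑-distrib-+ {zero}  f g = refl
∑-distrib-+ {suc m} f g = begin
  (f fzero + g fzero) + ∑ (λ i → f (fsuc i) + g (fsuc i))
    ≡⟨ cong (f fzero + g fzero +_) (∑-distrib-+ (f ∘ fsuc) (g ∘ fsuc)) ⟩
  (f fzero + g fzero) + (∑ (f ∘ fsuc) + ∑ (g ∘ fsuc))
    ≡⟨ interchange (f fzero) (g fzero) _ _ ⟩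
  ∑ f + ∑ g ∎

∑-comm : ∀ {m p} (F : Fin m → Fin p → ℕ) → ∑ (λ i → ∑ (F i)) ≡ ∑ (λ j → ∑ (λ i → F i j))
∑-comm {zero}  {p} F = sym (∑-zero p)
∑-comm {suc m}     F = begin
  ∑ (F fzero) + ∑ (λ i → ∑ (F (fsuc i)))         ≡⟨ cong (∑ (F fzero) +_) (∑-comm (F ∘ fsuc)) ⟩
  ∑ (F fzero) + ∑ (λ j → ∑ (λ i → F (fsuc i) j)) ≡⟨ ∑-distrib-+ (F fzero) _ ⟨
  ∑ (λ j → ∑ (λ i → F i j))                      ∎

∑-if : ∀ {m} b (f : Fin m → ℕ) → (if b then ∑ f else 0) ≡ ∑ (λ i → if b then f i else 0)
∑-if {m} false f = sym (∑-zero m)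
∑-if     true  f = refl

𝟙 : Bool → ℕ
𝟙 b = if b then 1 else 0

𝟙ᶜ : Bool → ℕ
𝟙ᶜ b = if b then 0 else 1

𝟙≤1 : ∀ b → 𝟙 b ≤ 1
𝟙≤1 true  = s≤s z≤n
𝟙≤1 false = z≤n

𝟙-not : ∀ b → 𝟙 (not b) ≡ 𝟙ᶜ b
𝟙-not true  = refl
𝟙-not false = refl

𝟙-∉ : ∀ {b} → b ≢ true → 𝟙 b ≡ 0
𝟙-∉ {true}  b≢true = ⊥-elim (b≢true refl)
𝟙-∉ {false} _      = refl

1≤+⇒ : ∀ {a b} → 1 ≤ a + b → 1 ≤ a ⊎ 1 ≤ b
1≤+⇒ {zero}  1≤b = inj₂ 1≤b
1≤+⇒ {suc a} _   = inj₁ (s≤s z≤n)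

+≤1 : ∀ {a b} → a ≤ 1 → b ≤ 1 → (1 ≤ a → 1 ≤ b → Empty) → a + b ≤ 1
+≤1 {zero}          _   b≤1 _    = b≤1
+≤1 {suc _} {zero}  a≤1 _   _    = ≤-trans (≤-reflexive (+-identityʳ _)) a≤1
+≤1 {suc _} {suc _} _   _   both = ⊥-elim (both (s≤s z≤n) (s≤s z≤n))

m⊓[n+m⊓o]≡m⊓[n+o] : ∀ m n o → m ⊓ (n + m ⊓ o) ≡ m ⊓ (n + o)
m⊓[n+m⊓o]≡m⊓[n+o] m n o with ≤-total o m
... | inj₁ o≤m = cong (λ x → m ⊓ (n + x)) (m≥n⇒m⊓n≡n o≤m)
... | inj₂ m≤o = begin
  m ⊓ (n + m ⊓ o) ≡⟨ cong (λ x → m ⊓ (n + x)) (m≤n⇒m⊓n≡m m≤o) ⟩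
  m ⊓ (n + m)     ≡⟨ m≤n⇒m⊓n≡m (m≤n+m m n) ⟩
  m               ≡⟨ m≤n⇒m⊓n≡m (≤-trans m≤o (m≤n+m o n)) ⟨
  m ⊓ (n + o)     ∎

lookup-∩ : ∀ {m} (p q : Subset m) v → lookup (p ∩ q) v ≡ (lookup p v ∧ lookup q v)
lookup-∩ p q v = Vecₚ.lookup-zipWith _∧_ v p q

lookup-∩⁻ : ∀ {m} (p q : Subset m) {v} → lookup (p ∩ q) v ≡ true → lookup p v ≡ true × lookup q v ≡ true
lookup-∩⁻ p q {v} v∈p∩q with lookup p v | lookup q v | trans (sym (lookup-∩ p q v)) v∈p∩q
... | true  | true  | _  = refl , refl
... | true  | false | ()
... | false | _     | ()

lookup-─ : ∀ {m} (p q : Subset m) v → lookup (p ─ q) v ≡ (lookup p v ∧ not (lookup q v))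
lookup-─ (x ∷ p) (true  ∷ q) fzero    = sym (∧-zeroʳ x)
lookup-─ (x ∷ p) (false ∷ q) fzero    = sym (∧-identityʳ x)
lookup-─ (x ∷ p) (y     ∷ q) (fsuc v) = lookup-─ p q v

lookup-─⁺ : ∀ {m} (p q : Subset m) {v} → lookup p v ≡ true → lookup q v ≡ false → lookup (p ─ q) v ≡ true
lookup-─⁺ p q {v} v∈p v∉q = trans (lookup-─ p q v) (cong₂ (λ a b → a ∧ not b) v∈p v∉q)

lookup-─⁻ : ∀ {m} (p q : Subset m) {v} → lookup (p ─ q) v ≡ true → lookup p v ≡ true × lookup q v ≡ false
lookup-─⁻ p q {v} v∈p─q with lookup p v | lookup q v | trans (sym (lookup-─ p q v)) v∈p─q
... | true  | false | _  = refl , refl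
... | true  | true  | ()
... | false | _     | ()

lookup-⊥ : ∀ {m} (v : Fin m) → lookup ⊥ v ≡ false
lookup-⊥ v = Vecₚ.lookup-replicate v false

∉⊥ : ∀ {m} (v : Fin m) → lookup ⊥ v ≢ true
∉⊥ v v∈⊥ = not-¬ v∈⊥ (lookup-⊥ v)

∣p∣≡∑ : ∀ {m} (p : Subset m) → ∣ p ∣ ≡ ∑ (𝟙 ∘ lookup p)
∣p∣≡∑ []          = refl
∣p∣≡∑ (true  ∷ p) = cong suc (∣p∣≡∑ p)
∣p∣≡∑ (false ∷ p) = ∣p∣≡∑ p

∣p∩q∣≡∑ : ∀ {m} (p q : Subset m) → ∣ p ∩ q ∣ ≡ ∑ (λ v → if lookup p v then 𝟙 (lookup q v) else 0)
∣p∩q∣≡∑ p q =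
  trans (∣p∣≡∑ (p ∩ q)) (∑-cong (λ v → trans (cong 𝟙 (lookup-∩ p q v)) (𝟙-∧ (lookup p v) _)))
  where
  𝟙-∧ : ∀ a b → 𝟙 (a ∧ b) ≡ (if a then 𝟙 b else 0)
  𝟙-∧ true  b = refl
  𝟙-∧ false b = refl

lookup-∩-⊇ : ∀ {m} (p X : Subset m) {v} → lookup X v ≡ true → lookup (p ∩ X) v ≡ lookup p v
lookup-∩-⊇ p X {v} v∈X = trans (lookup-∩ p X v) (trans (cong (lookup p v ∧_) v∈X) (∧-identityʳ _))

∉─∩ : ∀ {m} (p q : Subset m) {x} → x ∈ p → x ∈ q ─ (p ∩ q) → Empty
∉─∩ p q {x} x∈p x∈q─p∩q =
  let (x∈q , x∉p∩q) = lookup-─⁻ q (p ∩ q) (Vecₚ.[]=⇒lookup x∈q─p∩q)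
  in not-¬ (trans (lookup-∩ p q x) (cong₂ _∧_ (Vecₚ.[]=⇒lookup x∈p) x∈q)) x∉p∩q

module _ {A : Set} where

  ∑ˡ : (A → ℕ) → List A → ℕ
  ∑ˡ f xs = sumL (map f xs)

  ∑ˡ-++ : ∀ (f : A → ℕ) xs ys → ∑ˡ f (xs ++ ys) ≡ ∑ˡ f xs + ∑ˡ f ys
  ∑ˡ-++ f xs ys = trans (cong sumL (Listₚ.map-++ f xs ys)) (sum-++ (map f xs) (map f ys))

  ∑ˡ-cong : ∀ {f g : A → ℕ} xs → (∀ x → f x ≡ g x) → ∑ˡ f xs ≡ ∑ˡ g xs
  ∑ˡ-cong []       f≗g = refl
  ∑ˡ-cong (x ∷ xs) f≗g = cong₂ _+_ (f≗g x) (∑ˡ-cong xs f≗g)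

  ∑ˡ-∑-comm : ∀ {m} (F : A → Fin m → ℕ) xs → ∑ˡ (λ x → ∑ (F x)) xs ≡ ∑ (λ v → ∑ˡ (λ x → F x v) xs)
  ∑ˡ-∑-comm {m} F []       = sym (∑-zero m)
  ∑ˡ-∑-comm     F (x ∷ xs) =
    trans (cong (∑ (F x) +_) (∑ˡ-∑-comm F xs)) (sym (∑-distrib-+ (F x) _))

  ∑ˡ-if-none : ∀ (f : A → Bool) xs → ∑ˡ (𝟙 ∘ f) xs ≡ 0 →
               ∀ (g : A → ℕ) → ∑ˡ (λ x → if f x then g x else 0) xs ≡ 0
  ∑ˡ-if-none f []       _ g = refl
  ∑ˡ-if-none f (x ∷ xs) none g with f x
  ... | false = ∑ˡ-if-none f xs none g

  any-none : ∀ (f : A → Bool) xs → ∑ˡ (𝟙 ∘ f) xs ≡ 0 →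
             ∀ (h : A → Bool) → any (λ x → f x ∧ h x) xs ≡ false
  any-none f []       _ h = refl
  any-none f (x ∷ xs) none h with f x
  ... | false = any-none f xs none h

  record Sole (f : A → Bool) (xs : List A) : Set where
    field
      elem         : A
      holds        : f elem ≡ true
      ∑ˡ-if-select : ∀ (g : A → ℕ) → ∑ˡ (λ x → if f x then g x else 0) xs ≡ g elem
      any-select   : ∀ (h : A → Bool) → any (λ x → f x ∧ h x) xs ≡ h elem

  count≡1⇒Sole : ∀ (f : A → Bool) xs → ∑ˡ (𝟙 ∘ f) xs ≡ 1 → Sole f xs
  count≡1⇒Sole f (x ∷ xs) once with f x in fx
  ... | false = record
    { elem         = elem
    ; holds        = holds
    ; ∑ˡ-if-select = λ g →
        trans (cong (λ b → (if b then g x else 0) + ∑ˡ (λ y → if f y then g y else 0) xs) fx) (∑ˡ-if-select g)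
    ; any-select   = λ h → trans (cong (λ b → (b ∧ h x) ∨ any (λ y → f y ∧ h y) xs) fx) (any-select h)
    }
    where open Sole (count≡1⇒Sole f xs once)
  ... | true  = record
    { elem         = x
    ; holds        = fx
    ; ∑ˡ-if-select = λ g → begin
        (if f x then g x else 0) + ∑ˡ (λ y → if f y then g y else 0) xs
          ≡⟨ cong₂ (λ b c → (if b then g x else 0) + c) fx (∑ˡ-if-none f xs none g) ⟩
        g x + 0 ≡⟨ +-identityʳ (g x) ⟩
        g x     ∎
    ; any-select   = λ h → begin
        (f x ∧ h x) ∨ any (λ y → f y ∧ h y) xs
          ≡⟨ cong₂ (λ b c → (b ∧ h x) ∨ c) fx (any-none f xs none h) ⟩
        h x ∨ false ≡⟨ ∨-identityʳ (h x) ⟩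
        h x         ∎
    }
    where none = suc-injective once

∑ˡ-⊓ : ∀ {A : Set} d a (f : A → ℕ) xs → d ⊓ (a + ∑ˡ (λ x → d ⊓ f x) xs) ≡ d ⊓ (a + ∑ˡ f xs)
∑ˡ-⊓ d a f []       = refl
∑ˡ-⊓ d a f (x ∷ xs) = begin
  d ⊓ (a + (d ⊓ f x + ∑ˡ (λ y → d ⊓ f y) xs)) ≡⟨ cong (d ⊓_) (+-assoc a _ _) ⟨
  d ⊓ ((a + d ⊓ f x) + ∑ˡ (λ y → d ⊓ f y) xs) ≡⟨ ∑ˡ-⊓ d (a + d ⊓ f x) f xs ⟩
  d ⊓ ((a + d ⊓ f x) + ∑ˡ f xs)               ≡⟨ cong (d ⊓_) (xy∙z≈xz∙y a _ _) ⟩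
  d ⊓ ((a + ∑ˡ f xs) + d ⊓ f x)               ≡⟨ m⊓[n+m⊓o]≡m⊓[n+o] d _ _ ⟩
  d ⊓ ((a + ∑ˡ f xs) + f x)                   ≡⟨ cong (d ⊓_) (xy∙z≈x∙zy a _ _) ⟩
  d ⊓ (a + (f x + ∑ˡ f xs))                   ∎

-- Diversity as a sum over vertices
trues falses : ∀ {r} → (Fin r → Bool) → ℕ
trues  a = ∑ (𝟙 ∘ a)
falses a = ∑ (𝟙ᶜ ∘ a)

symDiff≡∑xor : ∀ {n} (E : Fin n → Fin n → Bool) (p q : Subset n) →
               symDiff E p q ≡ ∑ (λ v → 𝟙 (lookup p v xor lookup q v))
symDiff≡∑xor E p q = begin
  ∣ p ─ q ∣ + ∣ q ─ p ∣
    ≡⟨ cong₂ _+_ (∣p∣≡∑ (p ─ q)) (∣p∣≡∑ (q ─ p)) ⟩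
  ∑ (𝟙 ∘ lookup (p ─ q)) + ∑ (𝟙 ∘ lookup (q ─ p))
    ≡⟨ ∑-distrib-+ (𝟙 ∘ lookup (p ─ q)) _ ⟨
  ∑ (λ v → 𝟙 (lookup (p ─ q) v) + 𝟙 (lookup (q ─ p) v))
    ≡⟨ ∑-cong (λ v → cong₂ (λ a b → 𝟙 a + 𝟙 b) (lookup-─ p q v) (lookup-─ q p v)) ⟩
  ∑ (λ v → 𝟙 (lookup p v ∧ not (lookup q v)) + 𝟙 (lookup q v ∧ not (lookup p v)))
    ≡⟨ ∑-cong (λ v → 𝟙-xor (lookup p v) (lookup q v)) ⟩
  ∑ (λ v → 𝟙 (lookup p v xor lookup q v)) ∎
  where
  𝟙-xor : ∀ a b → 𝟙 (a ∧ not b) + 𝟙 (b ∧ not a) ≡ 𝟙 (a xor b)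
  𝟙-xor true  true  = refl
  𝟙-xor true  false = refl
  𝟙-xor false true  = refl
  𝟙-xor false false = refl

∑ᵢ<ⱼ : ∀ {r} → (Fin r → Fin r → ℕ) → ℕ
∑ᵢ<ⱼ F = ∑ (λ i → ∑ (λ j → if toℕ i <ᵇ toℕ j then F i j else 0))

∑ᵢ<ⱼ-cong : ∀ {r} {F G : Fin r → Fin r → ℕ} → (∀ i j → F i j ≡ G i j) → ∑ᵢ<ⱼ F ≡ ∑ᵢ<ⱼ G
∑ᵢ<ⱼ-cong F≗G = ∑-cong (λ i → ∑-cong (λ j → cong (if _ then_else 0) (F≗G i j)))

∑ᵢ<ⱼ-∑-comm : ∀ {r m} (F : Fin r → Fin r → Fin m → ℕ) →
              ∑ᵢ<ⱼ (λ i j → ∑ (F i j)) ≡ ∑ (λ v → ∑ᵢ<ⱼ (λ i j → F i j v))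
∑ᵢ<ⱼ-∑-comm F = begin
  ∑ (λ i → ∑ (λ j → if toℕ i <ᵇ toℕ j then ∑ (F i j) else 0))
    ≡⟨ ∑-cong (λ i → ∑-cong (λ j → ∑-if (toℕ i <ᵇ toℕ j) (F i j))) ⟩
  ∑ (λ i → ∑ (λ j → ∑ (G i j)))
    ≡⟨ ∑-cong (λ i → ∑-comm (G i)) ⟩
  ∑ (λ i → ∑ (λ v → ∑ (λ j → G i j v)))
    ≡⟨ ∑-comm (λ i v → ∑ (λ j → G i j v)) ⟩
  ∑ (λ v → ∑ᵢ<ⱼ (λ i j → F i j v)) ∎
  where
  G = λ i j v → if toℕ i <ᵇ toℕ j then F i j v else 0

∑-xor : ∀ {r} b (a : Fin r → Bool) → ∑ (λ j → 𝟙 (b xor a j)) ≡ (if b then falses a else trues a)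
∑-xor true  a = ∑-cong (𝟙-not ∘ a)
∑-xor false a = refl

∑ᵢ<ⱼ-xor : ∀ {r} (a : Fin r → Bool) → ∑ᵢ<ⱼ (λ i j → 𝟙 (a i xor a j)) ≡ trues a * falses a
∑ᵢ<ⱼ-xor {zero}  a = refl
∑ᵢ<ⱼ-xor {suc r} a = begin
  ∑ (λ j → 𝟙 (a fzero xor a (fsuc j))) + ∑ᵢ<ⱼ (λ i j → 𝟙 (a (fsuc i) xor a (fsuc j)))
    ≡⟨ cong₂ _+_ (∑-xor (a fzero) (a ∘ fsuc)) (∑ᵢ<ⱼ-xor (a ∘ fsuc)) ⟩
  (if a fzero then falses (a ∘ fsuc) else trues (a ∘ fsuc)) + trues (a ∘ fsuc) * falses (a ∘ fsuc)
    ≡⟨ expand (a fzero) (trues (a ∘ fsuc)) (falses (a ∘ fsuc)) ⟩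
  trues a * falses a ∎
  where
  expand : ∀ b t f → (if b then f else t) + t * f ≡ (𝟙 b + t) * (𝟙ᶜ b + f)
  expand true  t f = refl
  expand false t f = sym (*-suc t f)

I-cong : ∀ {n r} (S S′ : Fin r → Subset n) v → (∀ l → lookup (S l) v ≡ lookup (S′ l) v) → I S v ≡ I S′ v
I-cong S S′ v S≗S′ = cong₂ _*_ (∑-cong (cong 𝟙 ∘ S≗S′)) (∑-cong (cong 𝟙ᶜ ∘ S≗S′))

diversity≡∑I : ∀ {n r} (E : Fin n → Fin n → Bool) (S : Fin r → Subset n) → diversity E S ≡ ∑ (I S)
diversity≡∑I E S = begin
  ∑ᵢ<ⱼ (λ i j → symDiff E (S i) (S j))
    ≡⟨ ∑ᵢ<ⱼ-cong (λ i j → symDiff≡∑xor E (S i) (S j)) ⟩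
  ∑ᵢ<ⱼ (λ i j → ∑ (λ v → 𝟙 (lookup (S i) v xor lookup (S j) v)))
    ≡⟨ ∑ᵢ<ⱼ-∑-comm (λ i j v → 𝟙 (lookup (S i) v xor lookup (S j) v)) ⟩
  ∑ (λ v → ∑ᵢ<ⱼ (λ i j → 𝟙 (lookup (S i) v xor lookup (S j) v)))
    ≡⟨ ∑-cong (λ v → ∑ᵢ<ⱼ-xor (λ l → lookup (S l) v)) ⟩
  ∑ (I S) ∎

-- Every vertex is forgotten at exactly one node
≼-refl : ∀ x → x ≼ x
≼-refl x = [] , Listₚ.++-identityʳ x

≼-trans : ∀ {x y z} → x ≼ y → y ≼ z → x ≼ z
≼-trans {x} (w₁ , refl) (w₂ , refl) = w₁ ++ w₂ , sym (Listₚ.++-assoc x w₁ w₂)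

≼-++ : ∀ x w → x ≼ (x ++ w)
≼-++ x w = w , refl

≼-siblings : ∀ z {a b w₁ w₂ w} → a ≢ b → w ≼ (z ++ a ∷ w₁) → w ≼ (z ++ b ∷ w₂) → w ≼ z
≼-siblings []      {w = []}    a≢b _         _         = ≼-refl []
≼-siblings []      {w = c ∷ w} a≢b (_ , c≡a) (_ , c≡b) =
  ⊥-elim (a≢b (trans (sym (Listₚ.∷-injectiveˡ c≡a)) (Listₚ.∷-injectiveˡ c≡b)))
≼-siblings (c ∷ z) {w = []}    a≢b _         _         = c ∷ z , refl
≼-siblings (c ∷ z) {w = c′ ∷ w} a≢b (u₁ , e₁) (u₂ , e₂) with Listₚ.∷-injectiveˡ e₁
... | refl = let (u , e) = ≼-siblings z a≢b (u₁ , Listₚ.∷-injectiveʳ e₁) (u₂ , Listₚ.∷-injectiveʳ e₂)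
             in u , cong (c ∷_) e

SubtreeAt-++ : ∀ {n} {T t u : Tree n} {z w} → SubtreeAt T z t → SubtreeAt t w u → SubtreeAt T (z ++ w) u
SubtreeAt-++ here         s = s
SubtreeAt-++ (there i s₁) s = there i (SubtreeAt-++ s₁ s)

-- A node is recorded by its parent's bag (nothing at the root) and its own bag, which is
-- all that forg needs.
Place : ℕ → Set
Place n = Maybe (Subset n) × Subset n

forgotten : ∀ {n} → Place n → Subset n
forgotten (par , X) = forg par X

places : ∀ {n} → Maybe (Subset n) → Tree n → List (Place n)
childPlaces : ∀ {n} → Subset n → List (Tree n) → List (Place n)
places par (node X ts) = (par , X) ∷ childPlaces X ts
childPlaces X []       = []
childPlaces X (t ∷ ts) = places (just X) t ++ childPlaces X ts

forgets : ∀ {n} → Fin n → Place n → Bool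
forgets v e = lookup (forgotten e) v

#forgetting : ∀ {n} → Fin n → List (Place n) → ℕ
#forgetting v = ∑ˡ (𝟙 ∘ forgets v)

forgotten⊆bag : ∀ {n} (e : Place n) {v} → forgets v e ≡ true → lookup (proj₂ e) v ≡ true
forgotten⊆bag (nothing , X) {v} v∈⊥ = ⊥-elim (∉⊥ v v∈⊥)
forgotten⊆bag (just P  , X) v∈X─P = proj₁ (lookup-─⁻ X P v∈X─P)

∑ˡ-places-child≤ : ∀ {n} (f : Place n → ℕ) X ts (i : Fin (length ts)) →
                   ∑ˡ f (places (just X) (List.lookup ts i)) ≤ ∑ˡ f (childPlaces X ts)
∑ˡ-places-child≤ f X (t ∷ ts) i =
  ≤-trans (lookup≤ i) (≤-reflexive (sym (∑ˡ-++ f (places (just X) t) _)))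
  where
  lookup≤ : ∀ i → ∑ˡ f (places (just X) (List.lookup (t ∷ ts) i)) ≤
                   ∑ˡ f (places (just X) t) + ∑ˡ f (childPlaces X ts)
  lookup≤ fzero    = m≤m+n _ _
  lookup≤ (fsuc i) = ≤-trans (∑ˡ-places-child≤ f X ts i) (m≤n+m _ _)

inBag⇒inParent⊎forgotten : ∀ {n} (v : Fin n) P X ts → lookup X v ≡ true →
                           lookup P v ≡ true ⊎ 1 ≤ #forgetting v (places (just P) (node X ts))
inBag⇒inParent⊎forgotten v P X ts v∈X with lookup P v in v∈P
... | true  = inj₁ refl
... | false = inj₂ (≤-trans (≤-reflexive (cong 𝟙 (sym (lookup-─⁺ X P v∈X v∈P)))) (m≤m+n _ _))

inSubtree⇒inParent⊎forgotten : ∀ {n} (v : Fin n) P {t₀ p t} → SubtreeAt t₀ p t → lookup (bag t) v ≡ true →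
                               lookup P v ≡ true ⊎ 1 ≤ #forgetting v (places (just P) t₀)
inSubtree⇒inParent⊎forgotten v P {node X ts} here        v∈X = inBag⇒inParent⊎forgotten v P X ts v∈X
inSubtree⇒inParent⊎forgotten v P {node X ts} (there i s) v∈t with inSubtree⇒inParent⊎forgotten v X s v∈t
... | inj₁ v∈X = inBag⇒inParent⊎forgotten v P X ts v∈X
... | inj₂ 1≤# = inj₂ (≤-trans 1≤# (≤-trans (∑ˡ-places-child≤ (𝟙 ∘ forgets v) X ts i) (m≤n+m _ _)))

∑ˡ-childPlaces : ∀ {n} (f : Place n → ℕ) X ts →
                 ∑ˡ f (childPlaces X ts) ≡ ∑ˡ (λ t → ∑ˡ f (places (just X) t)) ts
∑ˡ-childPlaces f X []       = refl
∑ˡ-childPlaces f X (t ∷ ts) = trans (∑ˡ-++ f (places (just X) t) _) (cong (_ +_) (∑ˡ-childPlaces f X ts))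

∑ˡ-forgotten : ∀ {n} {A : Set} (π : A → Place n) L (sole : ∀ v → Sole (forgets v ∘ π) L) (g : A → Fin n → ℕ) →
               ∑ˡ (λ x → ∑ (λ v → if forgets v (π x) then g x v else 0)) L
               ≡ ∑ (λ v → g (Sole.elem (sole v)) v)
∑ˡ-forgotten π L sole g =
  trans (∑ˡ-∑-comm (λ x v → if forgets v (π x) then g x v else 0) L)
        (∑-cong (λ v → Sole.∑ˡ-if-select (sole v) (λ x → g x v)))

PathProperty : ∀ {n} → Tree n → Set
PathProperty T = ∀ x y z tx ty tz → SubtreeAt T x tx → SubtreeAt T y ty → SubtreeAt T z tz →
                 OnPath x y z → (bag tx ∩ bag ty) ⊆ bag tz

module AtMostOnce {n} (T : Tree n) (path : PathProperty T) (v : Fin n) where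

  Holds : Tree n → Set
  Holds t = lookup (bag t) v ≡ true

  holds-on-path : ∀ {x y z tx ty tz} → SubtreeAt T x tx → SubtreeAt T y ty → SubtreeAt T z tz →
                  OnPath x y z → Holds tx → Holds ty → Holds tz
  holds-on-path {x} {y} {z} {tx} {ty} {tz} sx sy sz onPath hx hy =
    Vecₚ.[]=⇒lookup (path x y z tx ty tz sx sy sz onPath
      (Vecₚ.lookup⇒[]= v (bag tx ∩ bag ty) (trans (lookup-∩ (bag tx) (bag ty) v) (cong₂ _∧_ hx hy))))

  OccursBelow : List ℕ → Set
  OccursBelow y = Σ (List ℕ) λ w → Σ (Tree n) λ t → SubtreeAt T (y ++ w) t × Holds t

  OccursBelow-parent : ∀ y a → OccursBelow (y ++ a ∷ []) → OccursBelow y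
  OccursBelow-parent y a (w , t , s , h) =
    a ∷ w , t , subst (λ p → SubtreeAt T p t) (Listₚ.++-assoc y (a ∷ []) w) s , h

  -- Addresses of a suffix of the children of the node at address z.
  record ChildAddresses (z : List ℕ) (cs : List (Tree n)) : Set where
    field
      index           : Fin (length cs) → ℕ
      index-injective : ∀ {i j} → index i ≡ index j → i ≡ j
      at              : ∀ i → SubtreeAt T (z ++ index i ∷ []) (List.lookup cs i)

  childAddresses : ∀ {z X cs} → SubtreeAt T z (node X cs) → ChildAddresses z cs
  childAddresses s = record
    { index           = toℕ
    ; index-injective = Finₚ.toℕ-injective
    ; at              = λ i → SubtreeAt-++ s (there i here)
    }

  drop-first : ∀ {z c cs} → ChildAddresses z (c ∷ cs) → ChildAddresses z cs
  drop-first ca = record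
    { index           = index ∘ fsuc
    ; index-injective = Finₚ.suc-injective ∘ index-injective
    ; at              = at ∘ fsuc
    }
    where open ChildAddresses ca

  notForgottenBelow : ∀ {x tx z X cs₀} → SubtreeAt T x tx → Holds tx → SubtreeAt T z (node X cs₀) → x ≼ z →
                      ∀ {cs} → ChildAddresses z cs → #forgetting v (childPlaces X cs) ≡ 0
  notForgottenBelow _ _ _ _ {[]} _ = refl
  notForgottenBelow {z = z} {X} sx hx sz x≼z {node Y ds ∷ cs} ca = begin
    #forgetting v (places (just X) (node Y ds) ++ childPlaces X cs)
      ≡⟨ ∑ˡ-++ (𝟙 ∘ forgets v) (places (just X) (node Y ds)) _ ⟩
    (𝟙 (lookup (Y ─ X) v) + #forgetting v (childPlaces Y ds)) + #forgetting v (childPlaces X cs)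
      ≡⟨ cong₂ _+_ (cong₂ _+_ (𝟙-∉ notForgottenHere)
                              (notForgottenBelow sx hx (at fzero) x≼child (childAddresses (at fzero))))
                   (notForgottenBelow sx hx sz x≼z (drop-first ca)) ⟩
    0 ∎
    where
    open ChildAddresses ca
    x≼child = ≼-trans x≼z (≼-++ z _)
    notForgottenHere : lookup (Y ─ X) v ≢ true
    notForgottenHere v∈Y─X = let (v∈Y , v∉X) = lookup-─⁻ Y X v∈Y─X in
      not-¬ (holds-on-path sx (at fzero) sz (inj₂ (≼-++ z _) , λ w w≼x _ → ≼-trans w≼x x≼z) hx v∈Y) v∉X

  occursBelow : ∀ {y par t} → SubtreeAt T y t → 1 ≤ #forgetting v (places par t) → OccursBelow y
  occursBelowChild : ∀ {z X cs} (ca : ChildAddresses z cs) → 1 ≤ #forgetting v (childPlaces X cs) →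
                     Σ (Fin (length cs)) λ i → OccursBelow (z ++ ChildAddresses.index ca i ∷ [])
  occursBelow {y} {par} {node Y ds} sy 1≤# with forgets v (par , Y) in v∈forg
  ... | true  = [] , node Y ds , subst (λ p → SubtreeAt T p (node Y ds)) (sym (Listₚ.++-identityʳ y)) sy
              , forgotten⊆bag (par , Y) v∈forg
  ... | false = let (i , occ) = occursBelowChild {X = Y} {ds} (childAddresses sy) 1≤#
                in OccursBelow-parent y (toℕ i) occ
  occursBelowChild {X = X} {c ∷ cs} ca 1≤#
    with 1≤+⇒ (≤-trans 1≤# (≤-reflexive (∑ˡ-++ (𝟙 ∘ forgets v) (places (just X) c) (childPlaces X cs))))
  ... | inj₁ 1≤#c  = fzero , occursBelow {t = c} (ChildAddresses.at ca fzero) 1≤#c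
  ... | inj₂ 1≤#cs = let (i , occ) = occursBelowChild (drop-first ca) 1≤#cs in fsuc i , occ

  siblingsDisjoint : ∀ {z X cs} → SubtreeAt T z (node X cs) → lookup X v ≡ false →
                     ∀ {a b} → OccursBelow (z ++ a ∷ []) → OccursBelow (z ++ b ∷ []) → a ≡ b
  siblingsDisjoint {z} sz v∉X {a} {b} (w₁ , t₁ , s₁ , h₁) (w₂ , t₂ , s₂ , h₂) with a ≟ b
  ... | yes a≡b = a≡b
  ... | no  a≢b = ⊥-elim (not-¬ (holds-on-path s₁ s₂ sz (z≼x , common) h₁ h₂) v∉X)
    where
    z≼x = inj₁ (≼-trans (≼-++ z (a ∷ [])) (≼-++ (z ++ a ∷ []) w₁))
    common : ∀ w → w ≼ ((z ++ a ∷ []) ++ w₁) → w ≼ ((z ++ b ∷ []) ++ w₂) → w ≼ z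
    common w p q = ≼-siblings z a≢b (subst (w ≼_) (Listₚ.++-assoc z (a ∷ []) w₁) p)
                                     (subst (w ≼_) (Listₚ.++-assoc z (b ∷ []) w₂) q)

  atMostOnce : ∀ {y P Y ds} → SubtreeAt T y (node Y ds) → #forgetting v (places (just P) (node Y ds)) ≤ 1
  atMostOnceChildren : ∀ {z X cs₀} → SubtreeAt T z (node X cs₀) → lookup X v ≡ false →
                       ∀ {cs} → ChildAddresses z cs → #forgetting v (childPlaces X cs) ≤ 1
  atMostOnce {y} {P} {Y} {ds} sy with lookup Y v in v∈Y
  ... | true  = ≤-trans (≤-reflexive (trans (cong (𝟙 (lookup (Y ─ P) v) +_) noneBelow) (+-identityʳ _)))
                        (𝟙≤1 _)
    where noneBelow = notForgottenBelow sy v∈Y sy (≼-refl y) (childAddresses sy)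
  ... | false = ≤-trans (≤-reflexive (cong (_+ #forgetting v (childPlaces Y ds)) (𝟙-∉ notForgottenHere)))
                        (atMostOnceChildren sy v∈Y (childAddresses sy))
    where
    notForgottenHere : lookup (Y ─ P) v ≢ true
    notForgottenHere v∈Y─P = not-¬ (proj₁ (lookup-─⁻ Y P v∈Y─P)) v∈Y
  atMostOnceChildren sz v∉X {[]} ca = z≤n
  atMostOnceChildren {z} {X} sz v∉X {node Y ds ∷ cs} ca =
    ≤-trans (≤-reflexive (∑ˡ-++ (𝟙 ∘ forgets v) (places (just X) (node Y ds)) (childPlaces X cs)))
            (+≤1 (atMostOnce (at fzero)) (atMostOnceChildren sz v∉X (drop-first ca)) twoChildren)
    where
    open ChildAddresses ca
    twoChildren : 1 ≤ #forgetting v (places (just X) (node Y ds)) → 1 ≤ #forgetting v (childPlaces X cs) → Empty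
    twoChildren 1≤#c 1≤#cs with occursBelowChild {X = X} (drop-first ca) 1≤#cs
    ... | i , occ with index-injective (siblingsDisjoint sz v∉X (occursBelow {par = just X} (at fzero) 1≤#c) occ)
    ... | ()

forgottenExactlyOnce : ∀ {n E} {T : Tree n} → IsRootedTD E T → ∀ v → #forgetting v (places nothing T) ≡ 1
forgottenExactlyOnce {T = node .⊥ ts} (covered , _ , path , refl , _) v =
  trans (cong (λ b → 𝟙 b + #forgetting v (childPlaces ⊥ ts)) (lookup-⊥ v)) (≤-antisym atMost atLeast)
  where
  open AtMostOnce (node ⊥ ts) path v using (atMostOnceChildren; childAddresses)
  atMost : #forgetting v (childPlaces ⊥ ts) ≤ 1
  atMost = atMostOnceChildren here (lookup-⊥ v) (childAddresses here)
  atLeast : 1 ≤ #forgetting v (childPlaces ⊥ ts)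
  atLeast with covered v
  ... | _ , _ , here      , v∈root = ⊥-elim (∉⊥ v (Vecₚ.[]=⇒lookup v∈root))
  ... | _ , _ , there i s , v∈t    with inSubtree⇒inParent⊎forgotten v ⊥ s (Vecₚ.[]=⇒lookup v∈t)
  ...   | inj₁ v∈⊥ = ⊥-elim (∉⊥ v v∈⊥)
  ...   | inj₂ 1≤# = ≤-trans 1≤# (∑ˡ-places-child≤ (𝟙 ∘ forgets v) ⊥ ts i)

-- From vertex covers to a tuple of 𝓡_q
module FromCovers {n} (E : Fin n → Fin n → Bool) (k r d : ℕ) (S : Fin r → Subset n)
                  (covers : ∀ j → IsVertexCover E (S j)) where
  open DP E k r d

  ownSize : Fin r → Place n → ℕ
  ownSize j e = ∣ forgotten e ∩ (S j ∩ proj₂ e) ∣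

  weight : Place n → ℕ
  weight e = ∑ (λ v → if forgets v e then I (λ j → S j ∩ proj₂ e) v else 0)

  restrict : Maybe (Subset n) → Tree n → Tuple n r
  restrictAll : Subset n → List (Tree n) → List (Tuple n r)
  restrict par (node X ts) = tuple (λ j → S j ∩ X)
    (λ j → ownSize j (par , X) + ∑ˡ (λ σ → s σ j) (restrictAll X ts))
    (d ⊓ (weight (par , X) + ∑ˡ ℓ (restrictAll X ts)))
  restrictAll X []       = []
  restrictAll X (t ∷ ts) = restrict (just X) t ∷ restrictAll X ts

  restrict∈R : ∀ par t → (∀ j → s (restrict par t) j ≤ k) → R par t (restrict par t)
  restrictAll∈RCh : ∀ X ts → (∀ j → ∑ˡ (λ σ → s σ j) (restrictAll X ts) ≤ k) →
                    RCh X (λ j → S j ∩ X) ts (restrictAll X ts)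
  restrict∈R par (node X ts) s≤k =
      ((λ j → p∩q⊆q (S j) X) , s≤k , m⊓n≤m d _)
    , noUncoveredEdge
    , restrictAll X ts , restrictAll∈RCh X ts (λ j → ≤-trans (m≤n+m _ _) (s≤k j)) , (λ j → refl) , refl
    where
    noUncoveredEdge : ∀ j u w → E u w ≡ true → u ∈ X ─ (S j ∩ X) → w ∈ X ─ (S j ∩ X) → Empty
    noUncoveredEdge j u w uw u∉ w∉ with covers j u w uw
    ... | inj₁ u∈S = ∉─∩ (S j) X u∈S u∉
    ... | inj₂ w∈S = ∉─∩ (S j) X w∈S w∉
  restrictAll∈RCh X []               _   = tt
  restrictAll∈RCh X (node Y ds ∷ ts) s≤k =
      restrict∈R (just X) (node Y ds) (λ j → ≤-trans (m≤m+n _ _) (s≤k j))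
    , (λ j → ∩-exchange (S j))
    , restrictAll∈RCh X ts (λ j → ≤-trans (m≤n+m _ _) (s≤k j))
    where
    ∩-exchange : ∀ p → (p ∩ X) ∩ Y ≡ (p ∩ Y) ∩ X
    ∩-exchange p = begin
      (p ∩ X) ∩ Y ≡⟨ ∩-assoc p X Y ⟩
      p ∩ (X ∩ Y) ≡⟨ cong (p ∩_) (∩-comm X Y) ⟩
      p ∩ (Y ∩ X) ≡⟨ ∩-assoc p Y X ⟨
      (p ∩ Y) ∩ X ∎

  s-restrict : ∀ j par t → s (restrict par t) j ≡ ∑ˡ (ownSize j) (places par t)
  s-restrictAll : ∀ j X ts → ∑ˡ (λ σ → s σ j) (restrictAll X ts) ≡ ∑ˡ (ownSize j) (childPlaces X ts)
  s-restrict j par (node X ts) = cong (ownSize j (par , X) +_) (s-restrictAll j X ts)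
  s-restrictAll j X []       = refl
  s-restrictAll j X (t ∷ ts) =
    trans (cong₂ _+_ (s-restrict j (just X) t) (s-restrictAll j X ts))
          (sym (∑ˡ-++ (ownSize j) (places (just X) t) _))

  ℓ-restrict : ∀ par t → ℓ (restrict par t) ≡ d ⊓ ∑ˡ weight (places par t)
  ℓ-restrictAll : ∀ X ts → ∑ˡ ℓ (restrictAll X ts) ≡ ∑ˡ (λ t → d ⊓ ∑ˡ weight (places (just X) t)) ts
  ℓ-restrict par (node X ts) = begin
    d ⊓ (weight (par , X) + ∑ˡ ℓ (restrictAll X ts))
      ≡⟨ cong (λ x → d ⊓ (weight (par , X) + x)) (ℓ-restrictAll X ts) ⟩
    d ⊓ (weight (par , X) + ∑ˡ (λ t → d ⊓ ∑ˡ weight (places (just X) t)) ts)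
      ≡⟨ ∑ˡ-⊓ d (weight (par , X)) (λ t → ∑ˡ weight (places (just X) t)) ts ⟩
    d ⊓ (weight (par , X) + ∑ˡ (λ t → ∑ˡ weight (places (just X) t)) ts)
      ≡⟨ cong (λ x → d ⊓ (weight (par , X) + x)) (∑ˡ-childPlaces weight X ts) ⟨
    d ⊓ ∑ˡ weight (places par (node X ts)) ∎
  ℓ-restrictAll X []       = refl
  ℓ-restrictAll X (t ∷ ts) = cong₂ _+_ (ℓ-restrict (just X) t) (ℓ-restrictAll X ts)

  module _ {T : Tree n} (td : IsRootedTD E T) where

    sole : ∀ v → Sole (forgets v) (places nothing T)
    sole v = count≡1⇒Sole (forgets v) (places nothing T) (forgottenExactlyOnce td v)

    v∈bag : ∀ v → lookup (proj₂ (Sole.elem (sole v))) v ≡ true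
    v∈bag v = forgotten⊆bag (Sole.elem (sole v)) (Sole.holds (sole v))

    ∑ˡ-ownSize : ∀ j → ∑ˡ (ownSize j) (places nothing T) ≡ ∣ S j ∣
    ∑ˡ-ownSize j = begin
      ∑ˡ (ownSize j) (places nothing T)
        ≡⟨ ∑ˡ-cong (places nothing T) (λ e → ∣p∩q∣≡∑ (forgotten e) (S j ∩ proj₂ e)) ⟩
      ∑ˡ (λ e → ∑ (λ v → if forgets v e then 𝟙 (lookup (S j ∩ proj₂ e) v) else 0)) (places nothing T)
        ≡⟨ ∑ˡ-forgotten id (places nothing T) sole (λ e v → 𝟙 (lookup (S j ∩ proj₂ e) v)) ⟩
      ∑ (λ v → 𝟙 (lookup (S j ∩ proj₂ (Sole.elem (sole v))) v))
        ≡⟨ ∑-cong (λ v → cong 𝟙 (lookup-∩-⊇ (S j) _ (v∈bag v))) ⟩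
      ∑ (𝟙 ∘ lookup (S j))
        ≡⟨ ∣p∣≡∑ (S j) ⟨
      ∣ S j ∣ ∎

    ∑ˡ-weight : ∑ˡ weight (places nothing T) ≡ ∑ (I S)
    ∑ˡ-weight = trans (∑ˡ-forgotten id (places nothing T) sole (λ e → I (λ j → S j ∩ proj₂ e)))
                      (∑-cong (λ v → I-cong (λ j → S j ∩ proj₂ (Sole.elem (sole v))) S v
                                                     (λ l → lookup-∩-⊇ (S l) _ (v∈bag v))))

    rootTuple : (∀ j → ∣ S j ∣ ≤ k) → d ≤ diversity E S → Σ (Tuple n r) (λ τ → R nothing T τ × ℓ τ ≡ d)
    rootTuple size≤k d≤div = restrict nothing T , restrict∈R nothing T s≤k , ℓ≡d (≤-trans d≤div div≤)
      where
      s≤k : ∀ j → s (restrict nothing T) j ≤ k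
      s≤k j = ≤-trans (≤-reflexive (trans (s-restrict j nothing T) (∑ˡ-ownSize j))) (size≤k j)
      div≤ : diversity E S ≤ ∑ˡ weight (places nothing T)
      div≤ = ≤-reflexive (trans (diversity≡∑I E S) (sym ∑ˡ-weight))
      ℓ≡d : d ≤ ∑ˡ weight (places nothing T) → ℓ (restrict nothing T) ≡ d
      ℓ≡d d≤ = trans (ℓ-restrict nothing T) (m≤n⇒m⊓n≡m d≤)

-- From a tuple of 𝓡_q to vertex covers
module ToCovers {n} (E : Fin n → Fin n → Bool) (k r d : ℕ) where
  open DP E k r d

  Entry : Set
  Entry = Place n × Tuple n r

  entries : ∀ par t τ → R par t τ → List Entry
  entriesBelow : ∀ par t τ → R par t τ → List Entry
  entriesAll : ∀ X S′ ts τs → RCh X S′ ts τs → List Entry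
  entries par (node X ts) τ ρ = ((par , X) , τ) ∷ entriesBelow par (node X ts) τ ρ
  entriesBelow par (node X ts) τ (_ , _ , τs , ρs , _) = entriesAll X (S τ) ts τs ρs
  entriesAll X S′ []       []       _            = []
  entriesAll X S′ (t ∷ ts) (σ ∷ σs) (ρ , _ , ρs) = entries (just X) t σ ρ ++ entriesAll X S′ ts σs ρs

  head∈entries : ∀ par t τ ρ → ((par , bag t) , τ) ∈ˡ entries par t τ ρ
  head∈entries par (node X ts) τ ρ = here refl

  entriesBelow⊆entries : ∀ par t τ ρ → entriesBelow par t τ ρ ⊆ˡ entries par t τ ρ
  entriesBelow⊆entries par (node X ts) τ ρ = there

  places-entries : ∀ par t τ ρ → map proj₁ (entries par t τ ρ) ≡ places par t
  places-entriesAll : ∀ X S′ ts τs ρs → map proj₁ (entriesAll X S′ ts τs ρs) ≡ childPlaces X ts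
  places-entries par (node X ts) τ (_ , _ , τs , ρs , _) =
    cong ((par , X) ∷_) (places-entriesAll X (S τ) ts τs ρs)
  places-entriesAll X S′ []       []       _            = refl
  places-entriesAll X S′ (t ∷ ts) (σ ∷ σs) (ρ , _ , ρs) =
    trans (Listₚ.map-++ proj₁ (entries (just X) t σ ρ) _)
          (cong₂ _++_ (places-entries (just X) t σ ρ) (places-entriesAll X S′ ts σs ρs))

  ownSize : Fin r → Entry → ℕ
  ownSize j x = ∣ forgotten (proj₁ x) ∩ S (proj₂ x) j ∣

  weight : Entry → ℕ
  weight x = ∑ (λ v → if forgets v (proj₁ x) then I (S (proj₂ x)) v else 0)

  s-entries : ∀ j par t τ ρ → s τ j ≡ ∑ˡ (ownSize j) (entries par t τ ρ)
  s-entriesAll : ∀ j X S′ ts τs ρs → ∑ˡ (λ σ → s σ j) τs ≡ ∑ˡ (ownSize j) (entriesAll X S′ ts τs ρs)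
  s-entries j par (node X ts) τ (_ , _ , τs , ρs , s≡ , _) =
    trans (s≡ j) (cong (_ +_) (s-entriesAll j X (S τ) ts τs ρs))
  s-entriesAll j X S′ []       []       _            = refl
  s-entriesAll j X S′ (t ∷ ts) (σ ∷ σs) (ρ , _ , ρs) =
    trans (cong₂ _+_ (s-entries j (just X) t σ ρ) (s-entriesAll j X S′ ts σs ρs))
          (sym (∑ˡ-++ (ownSize j) (entries (just X) t σ ρ) _))

  ℓ-entries : ∀ par t τ ρ → ℓ τ ≤ ∑ˡ weight (entries par t τ ρ)
  ℓ-entriesAll : ∀ X S′ ts τs ρs → ∑ˡ ℓ τs ≤ ∑ˡ weight (entriesAll X S′ ts τs ρs)
  ℓ-entries par (node X ts) τ (_ , _ , τs , ρs , _ , ℓ≡) =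
    ≤-trans (≤-reflexive ℓ≡) (≤-trans (m⊓n≤n d _) (+-monoʳ-≤ _ (ℓ-entriesAll X (S τ) ts τs ρs)))
  ℓ-entriesAll X S′ []       []       _            = z≤n
  ℓ-entriesAll X S′ (t ∷ ts) (σ ∷ σs) (ρ , _ , ρs) =
    ≤-trans (+-mono-≤ (ℓ-entries (just X) t σ ρ) (ℓ-entriesAll X S′ ts σs ρs))
            (≤-reflexive (sym (∑ˡ-++ weight (entries (just X) t σ ρ) _)))

  record ChildTuple (X : Subset n) (S′ : Fin r → Subset n) (t : Tree n) (L : List Entry) : Set where
    field
      σ        : Tuple n r
      σ∈R      : R (just X) t σ
      agrees   : ∀ j → S′ j ∩ bag t ≡ S σ j ∩ X
      entries⊆ : entries (just X) t σ σ∈R ⊆ˡ L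

  childTuple : ∀ X S′ ts τs (ρs : RCh X S′ ts τs) i →
               ChildTuple X S′ (List.lookup ts i) (entriesAll X S′ ts τs ρs)
  childTuple X S′ (t ∷ ts) (σ ∷ σs) (ρ , agrees , ρs) fzero =
    record { σ = σ ; σ∈R = ρ ; agrees = agrees ; entries⊆ = xs⊆xs++ys _ _ }
  childTuple X S′ (t ∷ ts) (τ ∷ τs) (ρ , _ , ρs) (fsuc i) = record
    { σ        = σ
    ; σ∈R      = σ∈R
    ; agrees   = agrees
    ; entries⊆ = xs⊆ys++xs _ (entries (just X) t τ ρ) ∘ entries⊆
    }
    where open ChildTuple (childTuple X S′ ts τs ρs i)

  hit : Fin r → Fin n → Entry → Bool
  hit j u x = forgets u (proj₁ x) ∧ lookup (S (proj₂ x) j) u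

  Hit : List Entry → Fin r → Fin n → Set
  Hit L j u = Σ Entry λ x → x ∈ˡ L × hit j u x ≡ true

  record Below (X₀ : Subset n) (σ₀ : Tuple n r) (L : List Entry) (t : Tree n) : Set where
    field
      σ      : Tuple n r
      covers : ∀ j u w → E u w ≡ true → u ∈ bag t ─ S σ j → w ∈ bag t ─ S σ j → Empty
      lifts  : ∀ j u → lookup (S σ j) u ≡ true →
               (lookup X₀ u ≡ true × lookup (S σ₀ j) u ≡ true) ⊎ Hit L j u

  -- Condition (a) moves a vertex of S_j from a child's tuple to its parent's as long as the
  -- vertex lies in the parent's bag; where it does not, the child forgets it.
  below : ∀ {par t₀ σ₀} (ρ₀ : R par t₀ σ₀) {p t} → SubtreeAt t₀ p t →
          Below (bag t₀) σ₀ (entriesBelow par t₀ σ₀ ρ₀) t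
  below {t₀ = node X ts} {σ₀} ρ₀@((S⊆X , _) , covers , _) here = record
    { σ      = σ₀
    ; covers = covers
    ; lifts  = λ j u u∈S → inj₁ (Vecₚ.[]=⇒lookup (S⊆X j (Vecₚ.lookup⇒[]= u _ u∈S)) , u∈S)
    }
  below {t₀ = node X ts} {σ₀} (_ , _ , τs , ρs , _) (there i s) = record
    { σ      = σ
    ; covers = covers
    ; lifts  = lifts′
    }
    where
    open ChildTuple (childTuple X (S σ₀) ts τs ρs i) renaming (σ to σc)
    child : Tree n
    child = List.lookup ts i
    open Below (below σ∈R s)
    lifts′ : ∀ j u → lookup (S σ j) u ≡ true →
             (lookup X u ≡ true × lookup (S σ₀ j) u ≡ true) ⊎ Hit (entriesAll X (S σ₀) ts τs ρs) j u
    lifts′ j u u∈S with lifts j u u∈S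
    ... | inj₂ (x , x∈ , h) = inj₂ (x , entries⊆ (entriesBelow⊆entries (just X) child σc σ∈R x∈) , h)
    ... | inj₁ (u∈child , u∈Sc) with lookup X u in u∈X
    ...   | true  = inj₁ (refl , proj₁ (lookup-∩⁻ (S σ₀ j) (bag child) inherited))
      where
      inherited : lookup (S σ₀ j ∩ bag child) u ≡ true
      inherited = trans (cong (λ p → lookup p u) (agrees j))
                        (trans (lookup-∩ (S σc j) X u) (cong₂ _∧_ u∈Sc u∈X))
    ...   | false = inj₂ (_ , entries⊆ (head∈entries (just X) child σc σ∈R)
                         , cong₂ _∧_ (lookup-─⁺ (bag child) X u∈child u∈X) u∈Sc)

  module Root {T : Tree n} (td : IsRootedTD E T) {τ : Tuple n r} (ρ : R nothing T τ) where

    L : List Entry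
    L = entries nothing T τ ρ

    sole : ∀ v → Sole (forgets v ∘ proj₁) L
    sole v = count≡1⇒Sole (forgets v ∘ proj₁) L (begin
      ∑ˡ (𝟙 ∘ forgets v ∘ proj₁) L      ≡⟨ cong sumL (Listₚ.map-∘ L) ⟩
      #forgetting v (map proj₁ L)        ≡⟨ cong (#forgetting v) (places-entries nothing T τ ρ) ⟩
      #forgetting v (places nothing T)   ≡⟨ forgottenExactlyOnce td v ⟩
      1                                  ∎)

    chosen : Fin n → Tuple n r
    chosen v = proj₂ (Sole.elem (sole v))

    U : Fin r → Subset n
    U j = tabulate (λ v → lookup (S (chosen v) j) v)

    lookup-U : ∀ j v → lookup (U j) v ≡ lookup (S (chosen v) j) v
    lookup-U j v = Vecₚ.lookup∘tabulate (λ v → lookup (S (chosen v) j) v) v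

    ∣U∣≡s : ∀ j → ∣ U j ∣ ≡ s τ j
    ∣U∣≡s j = begin
      ∣ U j ∣
        ≡⟨ ∣p∣≡∑ (U j) ⟩
      ∑ (𝟙 ∘ lookup (U j))
        ≡⟨ ∑-cong (cong 𝟙 ∘ lookup-U j) ⟩
      ∑ (λ v → 𝟙 (lookup (S (chosen v) j) v))
        ≡⟨ ∑ˡ-forgotten proj₁ L sole (λ x v → 𝟙 (lookup (S (proj₂ x) j) v)) ⟨
      ∑ˡ (λ x → ∑ (λ v → if forgets v (proj₁ x) then 𝟙 (lookup (S (proj₂ x) j) v) else 0)) L
        ≡⟨ ∑ˡ-cong L (λ x → ∣p∩q∣≡∑ (forgotten (proj₁ x)) (S (proj₂ x) j)) ⟨
      ∑ˡ (ownSize j) L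
        ≡⟨ s-entries j nothing T τ ρ ⟨
      s τ j ∎

    ℓ≤diversity : ℓ τ ≤ diversity E U
    ℓ≤diversity = ≤-trans (ℓ-entries nothing T τ ρ) (≤-reflexive (begin
      ∑ˡ weight L
        ≡⟨ ∑ˡ-forgotten proj₁ L sole (λ x → I (S (proj₂ x))) ⟩
      ∑ (λ v → I (S (chosen v)) v)
        ≡⟨ ∑-cong (λ v → I-cong (S (chosen v)) U v (λ l → sym (lookup-U l v))) ⟩
      ∑ (I U)
        ≡⟨ diversity≡∑I E U ⟨
      diversity E U ∎))

    Hit⇒∈U : ∀ {j u} → Hit L j u → u ∈ U j
    Hit⇒∈U {j} {u} (x , x∈L , h) = Vecₚ.lookup⇒[]= u (U j) (begin
      lookup (U j) u
        ≡⟨ lookup-U j u ⟩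
      lookup (S (chosen u) j) u
        ≡⟨ Sole.any-select (sole u) (λ y → lookup (S (proj₂ y) j) u) ⟨
      any (hit j u) L
        ≡⟨ Equivalence.to T-≡ (any⁺ (hit j u) (lose x∈L (Equivalence.from T-≡ h))) ⟩
      true ∎)

    isCover : (∀ u v → E u v ≡ true →
                 Σ (List ℕ) λ p → Σ (Tree n) λ t → SubtreeAt T p t × u ∈ bag t × v ∈ bag t) →
              bag T ≡ ⊥ → ∀ j → IsVertexCover E (U j)
    isCover edgeInBag rootEmpty j u w uw with edgeInBag u w uw
    ... | p , t , s , u∈t , w∈t = cover
      where
      open Below (below ρ s)
      inU : ∀ {x} → lookup (S σ j) x ≡ true → x ∈ U j
      inU {x} x∈S with lifts j x x∈S
      ... | inj₁ (x∈root , _) = ⊥-elim (∉⊥ x (subst (λ X → lookup X x ≡ true) rootEmpty x∈root))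
      ... | inj₂ (y , y∈ , h) = Hit⇒∈U (y , entriesBelow⊆entries nothing T τ ρ y∈ , h)
      uncovered : ∀ {x} → x ∈ bag t → lookup (S σ j) x ≡ false → x ∈ bag t ─ S σ j
      uncovered {x} x∈t x∉S = Vecₚ.lookup⇒[]= x _ (lookup-─⁺ (bag t) (S σ j) (Vecₚ.[]=⇒lookup x∈t) x∉S)
      cover : u ∈ U j ⊎ w ∈ U j
      cover with lookup (S σ j) u in u∈S | lookup (S σ j) w in w∈S
      ... | true  | _     = inj₁ (inU u∈S)
      ... | false | true  = inj₂ (inU w∈S)
      ... | false | false = ⊥-elim (covers j u w uw (uncovered u∈t u∈S) (uncovered w∈t w∈S))

  toCovers : ∀ {T} → IsRootedTD E T → ∀ {τ} → R nothing T τ → ℓ τ ≡ d → DiverseVC E k r d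
  toCovers {node X ts} td@(_ , edgeInBag , _ , rootEmpty , _) ρ@((_ , s≤k , _) , _) ℓ≡d =
      U
    , isCover edgeInBag rootEmpty
    , (λ j → ≤-trans (≤-reflexive (∣U∣≡s j)) (s≤k j))
    , ≤-trans (≤-reflexive (sym ℓ≡d)) ℓ≤diversity
    where open Root td ρ

lemma1 : (n : ℕ) (E : Fin n → Fin n → Bool) → IsSimpleGraph n E →
         (k r d : ℕ) (T : Tree n) → IsRootedTD E T →
         DiverseVC E k r d ⇔ Σ (Tuple n r) (λ τ → DP.R E k r d nothing T τ × ℓ τ ≡ d)
-- The proof does not use that G is simple.
lemma1 n E _ k r d T td = mk⇔
  (λ (S , covers , size≤k , d≤div) → FromCovers.rootTuple E k r d S covers td size≤k d≤div)
  (λ (τ , ρ , ℓ≡d) → ToCovers.toCovers E k r d td ρ ℓ≡d)
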